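{- Let $S[1:n]$ be a sequence of distinct real numbers and $k\ge3$. Consider a longest subsequence of $S[1:n]$ among those that are $k$-rollercoasters with the last run increasing (respectively, decreasing), let $r$ be its last run, and let $S[i]$ be the first element of $r$. Then $r$ is a longest increasing (respectively, decreasing) subsequence of $S[i:n]$.
   Context: $S[a:b]$ denotes the contiguous subsequence $(S[a],\dots,S[b])$. A subsequence is obtained by choosing indices $i_1<\dots<i_m$ (not necessarily contiguous). A run of a sequence is a maximal contiguous subsequence that is increasing or decreasing; a $k$-rollercoaster is a sequence every run of which has length at least $k$. -}

module Defs where

open import Level using (Level)
open import Data.Nat using (ℕ; _≤_; _<_; _∸_; suc)
open import Data.Fin using (Fin; toℕ) renaming (_<_ to _<ᶠ_)
open import Data.Product using (_×_; ∃-syntax)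
open import Data.Sum using (_⊎_)
open import Relation.Binary.PropositionalEquality using (_≡_; _≢_)
open import Relation.Nullary using (¬_)
open import Relation.Binary.Bundles using (StrictTotalOrder)

data Dir : Set where
  up down : Dir

module _ {c ℓ₁ ℓ₂ : Level} (O : StrictTotalOrder c ℓ₁ ℓ₂) where
  open StrictTotalOrder O using (_≈_) renaming (Carrier to A; _<_ to _⊏_)

  Before : Dir → A → A → Set ℓ₂
  Before up   x y = x ⊏ y
  Before down x y = y ⊏ x

  -- A finite sequence of length m is a function Fin m → A; positions are 0-based.

  Distinct : {m : ℕ} → (Fin m → A) → Set ℓ₁
  Distinct {m} T = ∀ (i j : Fin m) → i ≢ j → ¬ (T i ≈ T j)

  MonoSeq : Dir → {m : ℕ} → (Fin m → A) → Set ℓ₂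
  MonoSeq d {m} T = ∀ (i j : Fin m) → i <ᶠ j → Before d (T i) (T j)

  MonoOn : Dir → {m : ℕ} → (Fin m → A) → ℕ → ℕ → Set ℓ₂
  MonoOn d {m} T a b = ∀ (i j : Fin m) → a ≤ toℕ i → i <ᶠ j → toℕ j ≤ b → Before d (T i) (T j)

  Monotone : {m : ℕ} → (Fin m → A) → ℕ → ℕ → Set ℓ₂
  Monotone T a b = MonoOn up T a b ⊎ MonoOn down T a b

  Run : {m : ℕ} → (Fin m → A) → ℕ → ℕ → Set ℓ₂
  Run {m} T a b =
    a ≤ b × b < m × Monotone T a b ×
    (∀ a' b' → a' ≤ a → b ≤ b' → b' < m → Monotone T a' b' → a' ≡ a × b' ≡ b)

  Rollercoaster : ℕ → {m : ℕ} → (Fin m → A) → Set ℓ₂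
  Rollercoaster k T = ∀ a b → Run T a b → k ≤ suc (b ∸ a)

  LastRun : Dir → {m : ℕ} → (Fin m → A) → ℕ → Set ℓ₂
  LastRun d {m} T a = Run T a (m ∸ 1) × MonoOn d T a (m ∸ 1)

  SubseqIdx : {m n : ℕ} → (Fin m → Fin n) → Set
  SubseqIdx {m} ι = ∀ (i j : Fin m) → i <ᶠ j → ι i <ᶠ ι j

  RCSubseq : Dir → ℕ → {n : ℕ} → (Fin n → A) → {m : ℕ} → (Fin m → Fin n) → Set ℓ₂
  RCSubseq d k S {m} ι =
    SubseqIdx ι × Rollercoaster k (λ j → S (ι j)) × ∃[ a ] LastRun d (λ j → S (ι j)) a

module Submission where

-- A longest k-rollercoaster whose last run r starts at S[i] can be cut just before r and
-- continued by any subsequence κ of S[i:n] that is monotone in the direction of r, after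
-- prefixing S[i] when S[i] comes before κ's first element. The step into r goes against the
-- direction of r, so the junction still ends the previous run; hence the runs of the new
-- sequence are the runs before r together with one last run as long as κ. Maximality then
-- bounds the length of κ by that of r.

open import Defs
open import Level using (Level)
open import Function using (_∘_; case_of_)
open import Data.Nat using (ℕ; zero; suc; ≢-nonZero; _+_; _≤_; _<_; _∸_; z≤n; s≤s; s≤s⁻¹)
open import Data.Nat.Properties
open import Data.Fin as Fin using (Fin; toℕ; fromℕ<; inject≤; _↑ˡ_; _↑ʳ_)
open import Data.Fin.Properties
  using (toℕ-injective; toℕ<n; toℕ-fromℕ<; toℕ-inject≤; toℕ-↑ˡ; toℕ-↑ʳ; splitAt⁻¹-↑ˡ; splitAt⁻¹-↑ʳ)
  renaming (<-cmp to <ᶠ-cmp)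
open import Data.Vec.Functional using (_++_; _∷_)
open import Data.Vec.Functional.Properties using (lookup-++ˡ; lookup-++ʳ)
open import Data.Product using (_×_; _,_; proj₁; proj₂; map₂; ∃-syntax)
open import Data.Sum using (inj₁; inj₂)
import Data.Sum as Sum
open import Data.Empty using (⊥; ⊥-elim)
open import Relation.Nullary using (¬_; yes; no; contradiction)
open import Relation.Binary.PropositionalEquality
open import Relation.Binary.Bundles using (StrictTotalOrder)
open import Relation.Binary.Definitions using (Tri; tri<; tri≈; tri>)

private variable
  m m' a l p x y : ℕ

opposite : Dir → Dir
opposite up   = down
opposite down = up

opposite-≢ : ∀ e → opposite e ≢ e
opposite-≢ up   ()
opposite-≢ down ()

data AppendView (a l : ℕ) : Fin (a + l) → Set where
  left  : (u : Fin a) → AppendView a l (u ↑ˡ l)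
  right : (q : Fin l) → AppendView a l (a ↑ʳ q)

appendView : ∀ a l (j : Fin (a + l)) → AppendView a l j
appendView a l j with Fin.splitAt a j in eq
... | inj₁ u = subst (AppendView a l) (splitAt⁻¹-↑ˡ eq) (left u)
... | inj₂ q = subst (AppendView a l) (splitAt⁻¹-↑ʳ eq) (right q)

lookup-++ˡ-inject≤ : ∀ {b} {B : Set b} (f : Fin m → B) (a≤m : a ≤ m) (g : Fin l → B)
                     (j : Fin (a + l)) u →
                     toℕ j ≡ toℕ u → toℕ u < a → ((λ w → f (inject≤ w a≤m)) ++ g) j ≡ f u
lookup-++ˡ-inject≤ {a = a} {l = l} f a≤m g j u j≡u u<a with appendView a l j
... | left w  = trans (lookup-++ˡ _ g w)
                      (cong f (toℕ-injective (trans (toℕ-inject≤ w a≤m) (trans (sym (toℕ-↑ˡ w l)) j≡u))))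
... | right q = contradiction (subst (_< a) (trans (sym j≡u) (toℕ-↑ʳ a q)) u<a) (m+n≮m a (toℕ q))

lookup-++ʳ-toℕ : ∀ {b} {B : Set b} (f : Fin a → B) (g : Fin l → B) (j : Fin (a + l)) q →
                 toℕ j ≡ a + toℕ q → (f ++ g) j ≡ g q
lookup-++ʳ-toℕ {a = a} {l = l} f g j q j≡a+q with appendView a l j
... | left w   = contradiction (subst (_< a) (trans (sym (toℕ-↑ˡ w l)) j≡a+q) (toℕ<n w)) (m+n≮m a (toℕ q))
... | right q' = trans (lookup-++ʳ f g q')
                       (cong g (toℕ-injective (+-cancelˡ-≡ a _ _ (trans (sym (toℕ-↑ʳ a q')) j≡a+q))))

module _ {c ℓ₁ ℓ₂ : Level} (O : StrictTotalOrder c ℓ₁ ℓ₂) where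
  open StrictTotalOrder O
    using (_≈_; irrefl; asym; compare; <-respʳ-≈; <-respˡ-≈; module Eq)
    renaming (Carrier to A; _<_ to _⊏_; trans to ⊏-trans)

  before-trans : ∀ e {x y z : A} → Before O e x y → Before O e y z → Before O e x z
  before-trans up   x⊏y y⊏z = ⊏-trans x⊏y y⊏z
  before-trans down y⊏x z⊏y = ⊏-trans z⊏y y⊏x

  before-irrefl : ∀ e {x : A} → ¬ Before O e x x
  before-irrefl up   = irrefl Eq.refl
  before-irrefl down = irrefl Eq.refl

  before⇒opposite : ∀ e {x y : A} → Before O e y x → Before O (opposite e) x y
  before⇒opposite up   y⊏x = y⊏x
  before⇒opposite down x⊏y = x⊏y

  opposite⇒before : ∀ e {x y : A} → Before O (opposite e) x y → Before O e y x
  opposite⇒before up   y⊏x = y⊏x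
  opposite⇒before down x⊏y = x⊏y

  before-unique : ∀ e e' {x y : A} → Before O e x y → Before O e' x y → e ≡ e'
  before-unique up   up   _ _ = refl
  before-unique down down _ _ = refl
  before-unique up   down x⊏y y⊏x = ⊥-elim (asym x⊏y y⊏x)
  before-unique down up   y⊏x x⊏y = ⊥-elim (asym x⊏y y⊏x)

  before-cmp : ∀ e (x y : A) → Tri (Before O e x y) (x ≈ y) (Before O e y x)
  before-cmp up   x y = compare x y
  before-cmp down x y with compare x y
  ... | tri< x⊏y x≉y y⊀x = tri> y⊀x x≉y x⊏y
  ... | tri≈ x⊀y x≈y y⊀x = tri≈ y⊀x x≈y x⊀y
  ... | tri> x⊀y x≉y y⊏x = tri< y⊏x x≉y x⊀y

  before-respʳ : ∀ e {x y z : A} → y ≈ z → Before O e x y → Before O e x z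
  before-respʳ up   = <-respʳ-≈
  before-respʳ down = <-respˡ-≈

  ¬before-trans : ∀ e {x y z : A} → ¬ Before O e x y → Before O e x z → Before O e y z
  ¬before-trans e {x} {y} {z} x⋠y x≺z with before-cmp e y z
  ... | tri< y≺z _ _ = y≺z
  ... | tri≈ _ y≈z _ = contradiction (before-respʳ e (Eq.sym y≈z) x≺z) x⋠y
  ... | tri> _ _ z≺y = contradiction (before-trans e x≺z z≺y) x⋠y

  Step : Dir → (Fin m → A) → ℕ → Set ℓ₂
  Step e T p = ∀ u v → toℕ u ≡ p → toℕ v ≡ suc p → Before O e (T u) (T v)

  step-intro : ∀ e (T : Fin m → A) {u v} → toℕ u ≡ p → toℕ v ≡ suc p →
               Before O e (T u) (T v) → Step e T p
  step-intro e T u≡p v≡1+p u≺v u' v' u'≡p v'≡1+p =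
    subst₂ (λ s t → Before O e (T s) (T t))
      (toℕ-injective (trans u≡p (sym u'≡p))) (toℕ-injective (trans v≡1+p (sym v'≡1+p))) u≺v

  step-unique : ∀ e e' (T : Fin m → A) → suc p < m → Step e T p → Step e' T p → e ≡ e'
  step-unique {p = p} e e' T p+1<m s s' =
    before-unique e e' (s u v (toℕ-fromℕ< _) (toℕ-fromℕ< p+1<m))
                       (s' u v (toℕ-fromℕ< _) (toℕ-fromℕ< p+1<m))
    where
      u = fromℕ< (<-trans (n<1+n p) p+1<m)
      v = fromℕ< p+1<m

  same-step : ∀ s e (T : Fin m → A) (T' : Fin m' → A) → suc p < m →
              Step s T p → Step s T' p → Step e T p → Step e T' p
  same-step {p = p} s e T T' p+1<m sT sT' eT =
    subst (λ f → Step f T' p) (step-unique s e T p+1<m sT eT) sT'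

  monoOn⇒step : ∀ e (T : Fin m → A) → MonoOn O e T x y → x ≤ p → suc p ≤ y → Step e T p
  monoOn⇒step {x = x} {y} {p} e T mono x≤p p<y u v u≡p v≡1+p =
    mono u v (subst (x ≤_) (sym u≡p) x≤p) (subst₂ _<_ (sym u≡p) (sym v≡1+p) (n<1+n p))
             (subst (_≤ y) (sym v≡1+p) p<y)

  steps⇒monoOn : ∀ e (T : Fin m → A) x y → (∀ p → x ≤ p → suc p ≤ y → Step e T p) → MonoOn O e T x y
  steps⇒monoOn e T x zero _ u v _ u<v v≤0 = contradiction (≤-trans u<v v≤0) λ ()
  steps⇒monoOn {m = m} e T x (suc y) steps u v x≤u u<v v≤1+y with m≤n⇒m<n∨m≡n v≤1+y
  ... | inj₁ v<1+y = below u v x≤u u<v (s≤s⁻¹ v<1+y)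
    where below = steps⇒monoOn e T x y (λ p x≤p p<y → steps p x≤p (m≤n⇒m≤1+n p<y))
  ... | inj₂ v≡1+y with m≤n⇒m<n∨m≡n (s≤s⁻¹ (subst (suc (toℕ u) ≤_) v≡1+y u<v))
  ...   | inj₂ u≡y = steps y (subst (x ≤_) u≡y x≤u) ≤-refl u v u≡y v≡1+y
  ...   | inj₁ u<y = before-trans e (below u w x≤u (subst (toℕ u <_) (sym w≡y) u<y) (≤-reflexive w≡y))
                                    (steps y (≤-trans x≤u (<⇒≤ u<y)) ≤-refl w v w≡y v≡1+y)
    where
      below = steps⇒monoOn e T x y (λ p x≤p p<y → steps p x≤p (m≤n⇒m≤1+n p<y))
      y<m : y < m
      y<m = <-trans (n<1+n y) (subst (_< m) v≡1+y (toℕ<n v))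
      w = fromℕ< y<m
      w≡y = toℕ-fromℕ< y<m

  monoOn-stepˡ : ∀ e (T : Fin m → A) → Step e T x → MonoOn O e T (suc x) y → MonoOn O e T x y
  monoOn-stepˡ {x = x} {y = y} e T s mono = steps⇒monoOn e T x y λ p x≤p p<y →
    case m≤n⇒m<n∨m≡n x≤p of λ where
      (inj₁ x<p)  → monoOn⇒step e T mono x<p p<y
      (inj₂ refl) → s

  monoOn⇒monotone : ∀ e (T : Fin m → A) → MonoOn O e T x y → Monotone O T x y
  monoOn⇒monotone up   _ = inj₁
  monoOn⇒monotone down _ = inj₂

  monotone-transfer : ∀ {y'} (T : Fin m → A) (T' : Fin m' → A) → y' ≤ y →
                      (∀ e p → suc p ≤ y' → Step e T p → Step e T' p) →
                      Monotone O T x y → Monotone O T' x y'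
  monotone-transfer {y = y} {x = x} {y'} T T' y'≤y agree = Sum.map (transfer up) (transfer down)
    where
      transfer : ∀ e → MonoOn O e T x y → MonoOn O e T' x y'
      transfer e mono = steps⇒monoOn e T' x y' λ p x≤p p<y' →
        agree e p p<y' (monoOn⇒step e T mono x≤p (≤-trans p<y' y'≤y))

  monotone-noTurn : ∀ e (T : Fin m → A) → Monotone O T x y → y < m → x ≤ p → suc (suc p) ≤ y →
                    Step (opposite e) T p → Step e T (suc p) → ⊥
  monotone-noTurn {x = x} {y} {p} e T mono y<m x≤p p+2≤y back forth =
    Sum.[ noTurn up , noTurn down ]′ mono
    where
      p+2<m = ≤-<-trans p+2≤y y<m
      noTurn : ∀ f → MonoOn O f T x y → ⊥
      noTurn f monoF = opposite-≢ e (trans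
        (sym (step-unique f (opposite e) T (<-trans (n<1+n _) p+2<m)
                          (monoOn⇒step f T monoF x≤p (<⇒≤ p+2≤y)) back))
        (step-unique f e T p+2<m (monoOn⇒step f T monoF (m≤n⇒m≤1+n x≤p) p+2≤y) forth))

  step-before-run : ∀ e (T : Fin m → A) → Distinct O T → Run O T x y → MonoOn O e T x y →
                    suc p ≡ x → Step (opposite e) T p
  step-before-run {p = p} e T distinct (_ , y<m , _ , maximal) mono refl u v u≡p v≡1+p
    with before-cmp e (T u) (T v)
  ... | tri< u≺v _ _ =
    contradiction (proj₁ (maximal p _ (n≤1+n p) ≤-refl y<m (monoOn⇒monotone e T extended))) (1+n≢n ∘ sym)
    where extended = monoOn-stepˡ e T (step-intro e T u≡p v≡1+p u≺v) mono
  ... | tri≈ _ u≈v _ =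
    contradiction u≈v (distinct u v λ u≡v → 1+n≢n (trans (sym v≡1+p) (trans (cong toℕ (sym u≡v)) u≡p)))
  ... | tri> _ _ v≺u = before⇒opposite e v≺u

  run-restrict : (T : Fin m → A) (T' : Fin m' → A) → m ≤ m' →
                 (∀ e p → suc p < m → Step e T p → Step e T' p) →
                 (∀ e p → suc p < m → Step e T' p → Step e T p) →
                 Run O T' x y → y < m → Run O T x y
  run-restrict T T' m≤m' to from (x≤y , _ , mono , maximal) y<m =
    x≤y , y<m , monotone-transfer T' T ≤-refl (λ e p p<y → from e p (≤-<-trans p<y y<m)) mono ,
    λ x' y' x'≤x y≤y' y'<m mono' → maximal x' y' x'≤x y≤y' (<-≤-trans y'<m m≤m')
      (monotone-transfer T T' ≤-refl (λ e p p<y' → to e p (≤-<-trans p<y' y'<m)) mono')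

  SamePrefix : ℕ → (Fin m → A) → (Fin m' → A) → Set c
  SamePrefix a T T' = ∀ u u' → toℕ u ≡ toℕ u' → toℕ u < a → T u ≡ T' u'

  samePrefix-sym : (T : Fin m → A) (T' : Fin m' → A) → SamePrefix a T T' → SamePrefix a T' T
  samePrefix-sym {a = a} T T' same u' u u'≡u u'<a = sym (same u u' (sym u'≡u) (subst (_< a) u'≡u u'<a))

  samePrefix-step : ∀ e (T : Fin m → A) (T' : Fin m' → A) → SamePrefix a T T' →
                    suc p < a → suc p < m → Step e T p → Step e T' p
  samePrefix-step {a = a} {p = p} e T T' same p+1<a p+1<m s u' v' u'≡p v'≡1+p =
    subst₂ (Before O e)
      (same u u' (trans u≡p (sym u'≡p)) (subst (_< a) (sym u≡p) (<-trans (n<1+n p) p+1<a)))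
      (same v v' (trans v≡1+p (sym v'≡1+p)) (subst (_< a) (sym v≡1+p) p+1<a))
      (s u v u≡p v≡1+p)
    where
      u = fromℕ< (<-trans (n<1+n p) p+1<m)
      v = fromℕ< p+1<m
      u≡p = toℕ-fromℕ< (<-trans (n<1+n p) p+1<m)
      v≡1+p = toℕ-fromℕ< p+1<m

  subseqIdx-≤ : ∀ {n} (ι : Fin m → Fin n) → SubseqIdx O ι →
                ∀ u v → toℕ u ≤ toℕ v → toℕ (ι u) ≤ toℕ (ι v)
  subseqIdx-≤ ι ι↑ u v u≤v with m≤n⇒m<n∨m≡n u≤v
  ... | inj₁ u<v = <⇒≤ (ι↑ u v u<v)
  ... | inj₂ u≡v = ≤-reflexive (cong (toℕ ∘ ι) (toℕ-injective u≡v))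

  distinct-∘ : ∀ {n} (S : Fin n → A) (ι : Fin m → Fin n) → Distinct O S → SubseqIdx O ι →
               Distinct O (S ∘ ι)
  distinct-∘ S ι distinct ι↑ u v u≢v with <ᶠ-cmp u v
  ... | tri< u<v _ _ = distinct (ι u) (ι v) λ ιu≡ιv →
    n≮n _ (subst (λ z → toℕ (ι u) < toℕ z) (sym ιu≡ιv) (ι↑ u v u<v))
  ... | tri≈ _ u≡v _ = contradiction u≡v u≢v
  ... | tri> _ _ v<u = distinct (ι u) (ι v) λ ιu≡ιv →
    n≮n _ (subst (λ z → toℕ (ι v) < toℕ z) ιu≡ιv (ι↑ v u v<u))

  subseqIdx-∷ : ∀ {n} {z : Fin n} (κ : Fin (suc l) → Fin n) → toℕ z < toℕ (κ Fin.zero) →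
                SubseqIdx O κ → SubseqIdx O (z ∷ κ)
  subseqIdx-∷ κ z<κ₀ κ↑ Fin.zero    (Fin.suc j) _   = <-≤-trans z<κ₀ (subseqIdx-≤ κ κ↑ Fin.zero j z≤n)
  subseqIdx-∷ κ z<κ₀ κ↑ (Fin.suc j) (Fin.suc j') j<j' = κ↑ j j' (s≤s⁻¹ j<j')

  monoSeq-∷ : ∀ e {n} {z : Fin n} (h : Fin n → A) (κ : Fin (suc l) → Fin n) →
              Before O e (h z) (h (κ Fin.zero)) → MonoSeq O e (h ∘ κ) → MonoSeq O e (h ∘ (z ∷ κ))
  monoSeq-∷ e h κ z≺κ₀ mono Fin.zero    (Fin.suc Fin.zero)     _    = z≺κ₀
  monoSeq-∷ e h κ z≺κ₀ mono Fin.zero    (Fin.suc (Fin.suc j)) _    =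
    before-trans e z≺κ₀ (mono Fin.zero (Fin.suc j) (s≤s z≤n))
  monoSeq-∷ e h κ z≺κ₀ mono (Fin.suc j) (Fin.suc j')          j<j' = mono j j' (s≤s⁻¹ j<j')

  subseqIdx-++ : ∀ {n} (f : Fin a → Fin n) (g : Fin l → Fin n) → SubseqIdx O f → SubseqIdx O g →
                 (∀ u q → toℕ (f u) < toℕ (g q)) → SubseqIdx O (f ++ g)
  subseqIdx-++ {a = a} {l = l} f g f↑ g↑ f<g j j' j<j' with appendView a l j | appendView a l j'
  ... | left u  | left u'  = subst₂ (λ s t → toℕ s < toℕ t) (sym (lookup-++ˡ f g u)) (sym (lookup-++ˡ f g u'))
    (f↑ u u' (subst₂ _<_ (toℕ-↑ˡ u l) (toℕ-↑ˡ u' l) j<j'))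
  ... | left u  | right q' = subst₂ (λ s t → toℕ s < toℕ t) (sym (lookup-++ˡ f g u)) (sym (lookup-++ʳ f g q'))
    (f<g u q')
  ... | right q | left u'  =
    contradiction (<-trans (subst₂ _<_ (toℕ-↑ʳ a q) (toℕ-↑ˡ u' l) j<j') (toℕ<n u')) (m+n≮m a (toℕ q))
  ... | right q | right q' = subst₂ (λ s t → toℕ s < toℕ t) (sym (lookup-++ʳ f g q)) (sym (lookup-++ʳ f g q'))
    (g↑ q q' (+-cancelˡ-< a _ _ (subst₂ _<_ (toℕ-↑ʳ a q) (toℕ-↑ʳ a q') j<j')))

  monoOn-++ʳ : ∀ e {n} (h : Fin n → A) (f : Fin a → Fin n) (g : Fin l → Fin n) →
               MonoSeq O e (h ∘ g) → MonoOn O e (h ∘ (f ++ g)) a y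
  monoOn-++ʳ {a = a} {l = l} e h f g mono j j' a≤j j<j' _ with appendView a l j | appendView a l j'
  ... | left u  | _        = contradiction (subst (a ≤_) (toℕ-↑ˡ u l) a≤j) (<⇒≱ (toℕ<n u))
  ... | right q | left u'  =
    contradiction (≤-<-trans a≤j (<-trans j<j' (subst (_< a) (sym (toℕ-↑ˡ u' l)) (toℕ<n u')))) (n≮n a)
  ... | right q | right q' =
    subst₂ (λ s t → Before O e (h s) (h t)) (sym (lookup-++ʳ f g q)) (sym (lookup-++ʳ f g q'))
      (mono q q' (+-cancelˡ-< a _ _ (subst₂ _<_ (toℕ-↑ʳ a q) (toℕ-↑ʳ a q') j<j')))

  module ExtendLastRun (d : Dir) {k M M' a : ℕ} (T : Fin (suc M) → A) (T' : Fin (suc M') → A)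
    (2≤k : 2 ≤ k) (rc : Rollercoaster O k T) (last : LastRun O d T a)
    (turn : ∀ {p} → suc p ≡ a → Step (opposite d) T p)
    (M≤M' : M ≤ M') (same : SamePrefix a T T') (mono' : MonoOn O d T' a M')
    (turn' : ∀ {p} → suc p ≡ a → Step (opposite d) T' p) where

    run : Run O T a M
    run = proj₁ last

    a<M : a < M
    a<M = m∸n≢0⇒n<m λ M∸a≡0 →
      contradiction (≤-trans 2≤k (subst (λ z → k ≤ suc z) M∸a≡0 (rc a M run))) λ { (s≤s ()) }

    agree : ∀ e p → suc p ≤ M → (Step e T p → Step e T' p) × (Step e T' p → Step e T p)
    agree e p p<M with <-cmp (suc p) a
    ... | tri< p+1<a _ _ = samePrefix-step e T T' same p+1<a p+1<m
                         , samePrefix-step e T' T (samePrefix-sym T T' same) p+1<a p+1<m'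
      where p+1<m = s≤s p<M ; p+1<m' = s≤s (≤-trans p<M M≤M')
    ... | tri≈ _ p+1≡a _ = same-step (opposite d) e T T' (s≤s p<M) (turn p+1≡a) (turn' p+1≡a)
                         , same-step (opposite d) e T' T (s≤s (≤-trans p<M M≤M')) (turn' p+1≡a) (turn p+1≡a)
    ... | tri> _ _ a<p+1 = same-step d e T T' (s≤s p<M) forth forth'
                         , same-step d e T' T (s≤s (≤-trans p<M M≤M')) forth' forth
      where
        forth = monoOn⇒step d T (proj₂ last) (s≤s⁻¹ a<p+1) p<M
        forth' = monoOn⇒step d T' mono' (s≤s⁻¹ a<p+1) (≤-trans p<M M≤M')

    lastRun : LastRun O d T' a
    lastRun = (≤-trans (<⇒≤ a<M) M≤M' , n<1+n M' , monoOn⇒monotone d T' mono' , maximal) , mono'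
      where
        maximal : ∀ a' b' → a' ≤ a → M' ≤ b' → b' < suc M' → Monotone O T' a' b' → a' ≡ a × b' ≡ M'
        maximal a' b' a'≤a M'≤b' b'<1+M' monotone =
          proj₁ (proj₂ (proj₂ (proj₂ run)) a' M a'≤a ≤-refl (n<1+n M)
                  (monotone-transfer T' T (≤-trans M≤M' M'≤b') (λ e p p<M → proj₂ (agree e p p<M)) monotone)) ,
          ≤-antisym (s≤s⁻¹ b'<1+M') M'≤b'

    crosses-turn : x < a → M ≤ y → y < suc M' → ¬ Monotone O T' x y
    crosses-turn {x} {y} x<a M≤y y<1+M' monotone =
      monotone-noTurn d T' monotone y<1+M' (pred-mono-≤ x<a) p+2≤y (turn' p+1≡a) forth
      where
        p+1≡a = suc-pred a {{≢-nonZero (m<n⇒n≢0 x<a)}}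
        p+2≤y = subst (λ z → suc z ≤ y) (sym p+1≡a) (≤-trans a<M M≤y)
        forth = subst (Step d T') (sym p+1≡a) (monoOn⇒step d T' mono' ≤-refl (≤-trans a<M M≤M'))

    -- A run of T' either ends before M, and is then a run of T, or is [a, M']: a run starting
    -- before a and reaching M would contain the turn at a.
    rollercoaster : Rollercoaster O k T'
    rollercoaster x y run'@(_ , y<1+M' , monotone , maximal) with y <? M | a ≤? x
    ... | yes y<M | _ = rc x y (run-restrict T T' (s≤s M≤M') to from run' (<-trans y<M (n<1+n M)))
      where
        to = λ e p p<1+M → proj₁ (agree e p (s≤s⁻¹ p<1+M))
        from = λ e p p<1+M → proj₂ (agree e p (s≤s⁻¹ p<1+M))
    ... | no y≮M | yes a≤x =
      subst₂ (λ s t → k ≤ suc (t ∸ s)) (proj₁ is-lastRun) (proj₂ is-lastRun)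
             (≤-trans (rc a M run) (s≤s (∸-monoˡ-≤ a M≤M')))
      where is-lastRun = maximal a M' a≤x (s≤s⁻¹ y<1+M') (n<1+n M') (monoOn⇒monotone d T' mono')
    ... | no y≮M | no a≰x = ⊥-elim (crosses-turn (≰⇒> a≰x) (≮⇒≥ y≮M) y<1+M' monotone)

  extendLastRun : ∀ d {k a} (T : Fin m → A) (T' : Fin m' → A) → 2 ≤ k →
                  Rollercoaster O k T → LastRun O d T a → (∀ {p} → suc p ≡ a → Step (opposite d) T p) →
                  m ≤ m' → SamePrefix a T T' → MonoOn O d T' a (m' ∸ 1) →
                  (∀ {p} → suc p ≡ a → Step (opposite d) T' p) →
                  Rollercoaster O k T' × LastRun O d T' a
  extendLastRun {m = zero} d T T' _ _ ((_ , () , _) , _) _ _ _ _ _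
  extendLastRun {m = suc M} {m' = suc M'} d T T' 2≤k rc last turn (s≤s M≤M') same mono' turn' =
    rollercoaster , lastRun
    where open ExtendLastRun d T T' 2≤k rc last turn M≤M' same mono' turn'

module LongestLastRun {c ℓ₁ ℓ₂ : Level} (O : StrictTotalOrder c ℓ₁ ℓ₂) (d : Dir) {k n : ℕ} (2≤k : 2 ≤ k)
  (S : Fin n → StrictTotalOrder.Carrier O) (distinct : Distinct O S)
  {m : ℕ} (ι : Fin m → Fin n) (rc : RCSubseq O d k S ι)
  (maximum : ∀ m' (ι' : Fin m' → Fin n) → RCSubseq O d k S ι' → m' ≤ m)
  {a : ℕ} (last : LastRun O d (S ∘ ι) a) {i : Fin n} (ι-a : ∀ j → toℕ j ≡ a → ι j ≡ i) where

  T : Fin m → StrictTotalOrder.Carrier O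
  T = S ∘ ι

  ι↑ : SubseqIdx O ι
  ι↑ = proj₁ rc

  a<m : a < m
  a<m = ≤-<-trans (proj₁ (proj₁ last)) (proj₁ (proj₂ (proj₁ last)))

  ι-at-a : ι (fromℕ< a<m) ≡ i
  ι-at-a = ι-a _ (toℕ-fromℕ< a<m)

  after-a : ∀ j → a ≤ toℕ j → toℕ i ≤ toℕ (ι j)
  after-a j a≤j = subst (λ z → toℕ z ≤ toℕ (ι j)) ι-at-a
    (subseqIdx-≤ O ι ι↑ _ j (subst (_≤ toℕ j) (sym (toℕ-fromℕ< a<m)) a≤j))

  before-a : ∀ j → toℕ j < a → toℕ (ι j) < toℕ i
  before-a j j<a = subst (λ z → toℕ (ι j) < toℕ z) ι-at-a
    (ι↑ j _ (subst (toℕ j <_) (sym (toℕ-fromℕ< a<m)) j<a))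

  turn : ∀ {p} → suc p ≡ a → Step O (opposite d) T p
  turn = step-before-run O d T (distinct-∘ O S ι distinct ι↑) (proj₁ last) (proj₂ last)

  longest-monotone-notAfter : ∀ {l} (κ : Fin (suc l) → Fin n) → SubseqIdx O κ →
                              (∀ j → toℕ i ≤ toℕ (κ j)) → MonoSeq O d (S ∘ κ) →
                              ¬ Before O d (S i) (S (κ Fin.zero)) → suc l ≤ m ∸ a
  longest-monotone-notAfter {l} κ κ↑ κ-from mono i⊀κ₀ =
    ≮⇒≥ λ κ-longer →
      <⇒≱ (m<m' κ-longer) (maximum (a + suc l) ι' (ι'↑ , extended (<⇒≤ (m<m' κ-longer))))
    where
      a≤m = <⇒≤ a<m

      prefix : Fin a → Fin n
      prefix u = ι (inject≤ u a≤m)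

      ι' : Fin (a + suc l) → Fin n
      ι' = prefix ++ κ

      m<m' : m ∸ a < suc l → m < a + suc l
      m<m' κ-longer = ≤-<-trans (m≤n+m∸n m a) (+-monoʳ-< a κ-longer)

      ι'↑ : SubseqIdx O ι'
      ι'↑ = subseqIdx-++ O prefix κ
        (λ u v u<v → ι↑ _ _ (subst₂ _<_ (sym (toℕ-inject≤ u a≤m)) (sym (toℕ-inject≤ v a≤m)) u<v)) κ↑
        (λ u q → <-≤-trans (before-a _ (subst (_< a) (sym (toℕ-inject≤ u a≤m)) (toℕ<n u))) (κ-from q))

      same : SamePrefix O a T (S ∘ ι')
      same u u' u≡u' u<a = cong S (sym (lookup-++ˡ-inject≤ ι a≤m κ u' u (sym u≡u') u<a))

      turn' : ∀ {p} → suc p ≡ a → Step O (opposite d) (S ∘ ι') p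
      turn' {p} p+1≡a u' v' u'≡p v'≡1+p =
        before⇒opposite O d (subst₂ (λ s t → Before O d (S s) (S t)) (sym ι'v'≡κ₀) (sym ι'u'≡ιu) κ₀≺u)
        where
          p<a = subst (p <_) p+1≡a (n<1+n p)
          p<m = <-trans p<a a<m
          u = fromℕ< p<m
          ι'u'≡ιu : ι' u' ≡ ι u
          ι'u'≡ιu = lookup-++ˡ-inject≤ ι a≤m κ u' u (trans u'≡p (sym (toℕ-fromℕ< p<m)))
                                                    (subst (_< a) (sym (toℕ-fromℕ< p<m)) p<a)
          ι'v'≡κ₀ : ι' v' ≡ κ Fin.zero
          ι'v'≡κ₀ = lookup-++ʳ-toℕ prefix κ v' Fin.zero (trans v'≡1+p (trans p+1≡a (sym (+-identityʳ a))))
          i≺u : Before O d (S i) (T u)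
          i≺u = opposite⇒before O d (subst (λ z → Before O (opposite d) (T u) (S z)) ι-at-a
                  (turn p+1≡a u (fromℕ< a<m) (toℕ-fromℕ< p<m) (trans (toℕ-fromℕ< a<m) (sym p+1≡a))))
          κ₀≺u = ¬before-trans O d i⊀κ₀ i≺u

      extended : m ≤ a + suc l → Rollercoaster O k (S ∘ ι') × ∃[ a' ] LastRun O d (S ∘ ι') a'
      extended m≤m' = map₂ (a ,_)
        (extendLastRun O d T (S ∘ ι') 2≤k (proj₁ (proj₂ rc)) last turn m≤m' same
                       (monoOn-++ʳ O d S prefix κ mono) turn')

  longest-monotone : ∀ L (κ : Fin L → Fin n) → SubseqIdx O κ → (∀ j → toℕ i ≤ toℕ (κ j)) →
                     MonoSeq O d (S ∘ κ) → L ≤ m ∸ a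
  longest-monotone zero    _ _  _      _    = z≤n
  longest-monotone (suc l) κ κ↑ κ-from mono with before-cmp O d (S i) (S (κ Fin.zero))
  ... | tri< i≺κ₀ _ _ = ≤-trans (n≤1+n _)
          (longest-monotone-notAfter (i ∷ κ) (subseqIdx-∷ O κ i<κ₀ κ↑) from (monoSeq-∷ O d S κ i≺κ₀ mono)
                                     (before-irrefl O d))
    where
      i<κ₀ : toℕ i < toℕ (κ Fin.zero)
      i<κ₀ = ≤∧≢⇒< (κ-from Fin.zero) λ i≡κ₀ →
        before-irrefl O d (subst (λ z → Before O d (S i) (S z)) (sym (toℕ-injective i≡κ₀)) i≺κ₀)
      from : ∀ j → toℕ i ≤ toℕ ((i ∷ κ) j)
      from Fin.zero    = ≤-refl
      from (Fin.suc j) = κ-from j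
  ... | tri≈ i⊀κ₀ _ _ = longest-monotone-notAfter κ κ↑ κ-from mono i⊀κ₀
  ... | tri> i⊀κ₀ _ _ = longest-monotone-notAfter κ κ↑ κ-from mono i⊀κ₀

lemma16 : {c ℓ₁ ℓ₂ : Level} (O : StrictTotalOrder c ℓ₁ ℓ₂) (d : Dir) (k n : ℕ) →
    3 ≤ k → (S : Fin n → StrictTotalOrder.Carrier O) → Distinct O S →
    (m : ℕ) (ι : Fin m → Fin n) → RCSubseq O d k S ι →
    (∀ (m' : ℕ) (ι' : Fin m' → Fin n) → RCSubseq O d k S ι' → m' ≤ m) →
    (a : ℕ) → LastRun O d (λ j → S (ι j)) a →
    (i : Fin n) → (∀ (j : Fin m) → toℕ j ≡ a → ι j ≡ i) →
      ((∀ (j : Fin m) → a ≤ toℕ j → toℕ i ≤ toℕ (ι j))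
        × MonoOn O d (λ j → S (ι j)) a (m ∸ 1)
        × (∀ (L : ℕ) (κ : Fin L → Fin n) → SubseqIdx O κ →
             (∀ (j : Fin L) → toℕ i ≤ toℕ (κ j)) →
             MonoSeq O d (λ j → S (κ j)) → L ≤ m ∸ a))
lemma16 O d k n 3≤k S distinct m ι rc maximum a last i ι-a = after-a , proj₂ last , longest-monotone
  where open LongestLastRun O d (≤-trans (n≤1+n 2) 3≤k) S distinct ι rc maximum last ι-a
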